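{- Let $m>1$ be an integer. Define $sf(n,m)$ for integers $n$ by $sf(n,m)=0$ for $n<0$, $sf(0,m)=1$, and for $n>0$: $sf(n,m)=sf(n/m,m)$ if $n\equiv0\pmod m$, and $sf(n,m)=sf(n-r,m)+sf(n-m,m)$ if $n\equiv r\pmod m$ with $0<r<m$. Then for every integer $n\ge0$, $$sf(nm+1,m)=sf(nm+2,m)=\cdots=sf(nm+m-1,m)=\sum_{j=0}^{n}sf(j,m).$$
   Context: $sf(n,m)$ is the number of semi-$m$-Fibonacci partitions of $n$, characterized by the stated recurrence. -}

module Defs where

open import Data.Nat using (ℕ; zero; suc; _+_; _*_; _∸_; _<ᵇ_; NonZero)
open import Data.Nat.DivMod using (_/_; _%_)
open import Data.Bool using (if_then_else_)

-- Fuel-bounded evaluation of the recurrence for sf(n,m), restricted to n ≥ 0.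
-- Negative arguments only arise as n - m with n < m; those give 0 per the paper.
-- Every recursive call is on a strictly smaller natural (n/m < n, n - r < n,
-- n - m < n for n > 0), so fuel (suc n) is always enough.
sfFuel : (m : ℕ) → .{{NonZero m}} → ℕ → ℕ → ℕ
sfFuel m zero    n       = 0
sfFuel m (suc f) zero    = 1
sfFuel m (suc f) (suc k) with suc k % m
... | zero    = sfFuel m f (suc k / m)
... | suc r-1 = sfFuel m f (suc k ∸ suc r-1)
              + (if suc k <ᵇ m then 0 else sfFuel m f (suc k ∸ m))

sf : ℕ → (m : ℕ) → .{{NonZero m}} → ℕ
sf n m = sfFuel m (suc n) n

sumSf : ℕ → (m : ℕ) → .{{NonZero m}} → ℕ
sumSf zero    m = sf 0 m
sumSf (suc n) m = sumSf n m + sf (suc n) m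

-- Reducing nm + r (0 < r < m) by the recurrence gives
-- sf(nm + r) = sf(nm) + sf((n-1)m + r) = sf(n) + sf((n-1)m + r), and the
-- remainder r never changes, so unrolling down to sf(r) = sf(0) telescopes
-- into sf(n) + sf(n-1) + ... + sf(0).
module Submission where

open import Defs
open import Data.Bool using (true; false; T; if_then_else_)
open import Data.Bool.Properties using (¬-not; T-≡)
open import Data.Nat using (ℕ; zero; suc; _+_; _*_; _∸_; _≤_; _<_; _<ᵇ_; NonZero; s≤s; z<s)
open import Data.Nat.Properties
open import Data.Nat.DivMod
open import Data.Nat.Divisibility using (divides-refl)
open import Function.Bundles using (Equivalence)
open import Relation.Binary.PropositionalEquality
open import Relation.Nullary using (contradiction)

≤⇒<ᵇ≡false : ∀ {a b} → b ≤ a → (a <ᵇ b) ≡ false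
≤⇒<ᵇ≡false {a} {b} b≤a = ¬-not λ a<ᵇb → ≤⇒≯ b≤a (<ᵇ⇒< a b (subst T (sym a<ᵇb) _))

<⇒<ᵇ≡true : ∀ {a b} → a < b → (a <ᵇ b) ≡ true
<⇒<ᵇ≡true a<b = Equivalence.to T-≡ (<⇒<ᵇ a<b)

module _ (m : ℕ) .{{_ : NonZero m}} (1<m : 1 < m) where

  sfFuel-irrelevant : ∀ {f g} k → k < f → k < g → sfFuel m f k ≡ sfFuel m g k
  sfFuel-irrelevant {suc f} {suc g} zero    _         _         = refl
  sfFuel-irrelevant {suc f} {suc g} (suc k) (s≤s k<f) (s≤s k<g) with suc k % m
  ... | zero  = sfFuel-irrelevant (suc k / m)
                  (<-≤-trans (m/n<m (suc k) m 1<m) k<f) (<-≤-trans (m/n<m (suc k) m 1<m) k<g)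
  ... | suc r = cong₂ _+_ (recurse (suc k ∸ suc r) (s≤s (m∸n≤m k r)))
                          (cong (if suc k <ᵇ m then 0 else_)
                                (recurse (suc k ∸ m) (s≤s (∸-monoʳ-≤ (suc k) (<⇒≤ 1<m)))))
    where
    recurse : ∀ j → j < suc k → sfFuel m f j ≡ sfFuel m g j
    recurse j j<k = sfFuel-irrelevant j (<-≤-trans j<k k<f) (<-≤-trans j<k k<g)

  sfFuel≡sf : ∀ f k → k < f → sfFuel m f k ≡ sf k m
  sfFuel≡sf f k k<f = sfFuel-irrelevant k k<f ≤-refl

  sf-divisible : ∀ n → 0 < n → n % m ≡ 0 → sf n m ≡ sf (n / m) m
  sf-divisible (suc k) _ m∣n rewrite m∣n = sfFuel≡sf (suc k) (suc k / m) (m/n<m (suc k) m 1<m)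

  sf-residue : ∀ n r → 0 < r → n % m ≡ r → m ≤ n → sf n m ≡ sf (n ∸ r) m + sf (n ∸ m) m
  sf-residue zero    _       _ _      m≤0 = contradiction m≤0 (<⇒≱ (<-trans z<s 1<m))
  sf-residue (suc k) (suc r) _ n%m≡r  m≤n rewrite n%m≡r | ≤⇒<ᵇ≡false m≤n =
    cong₂ _+_ (sfFuel≡sf (suc k) (suc k ∸ suc r) (s≤s (m∸n≤m k r)))
              (sfFuel≡sf (suc k) (suc k ∸ m) (s≤s (∸-monoʳ-≤ (suc k) (<⇒≤ 1<m))))

  -- Here the remainder is n itself and n - m < 0, so the recurrence reads sf(n) = sf(0) + 0.
  sf-below-modulus : ∀ n → 0 < n → n < m → sf n m ≡ sf 0 m
  sf-below-modulus (suc k) _ n<m rewrite m<n⇒m%n≡m n<m | <⇒<ᵇ≡true n<m | n∸n≡0 k = refl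

  sf-multiple : ∀ n → sf (suc n * m) m ≡ sf (suc n) m
  sf-multiple n = begin
    sf (suc n * m) m         ≡⟨ sf-divisible (suc n * m) 0<n*m (m*n%n≡0 (suc n) m) ⟩
    sf (suc n * m / m) m     ≡⟨ cong (λ k → sf k m) (m*n/n≡m (suc n) m) ⟩
    sf (suc n) m             ∎
    where
    open ≡-Reasoning
    0<n*m : 0 < suc n * m
    0<n*m = <-≤-trans (<-trans z<s 1<m) (m≤m+n m (n * m))

  sf-multiple+residue : ∀ n r → 0 < r → r < m →
    sf (suc n * m + r) m ≡ sf (suc n * m) m + sf (n * m + r) m
  sf-multiple+residue n r 0<r r<m = begin
    sf (suc n * m + r) m                                   ≡⟨ sf-residue _ r 0<r residue m≤N ⟩
    sf (suc n * m + r ∸ r) m + sf (suc n * m + r ∸ m) m    ≡⟨ cong₂ (λ a b → sf a m + sf b m)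
                                                                (m+n∸n≡m (suc n * m) r) drop-m ⟩
    sf (suc n * m) m + sf (n * m + r) m                    ∎
    where
    open ≡-Reasoning
    residue : (suc n * m + r) % m ≡ r
    residue = trans (%-remove-+ˡ r (divides-refl (suc n))) (m<n⇒m%n≡m r<m)
    m≤N : m ≤ suc n * m + r
    m≤N = ≤-trans (m≤m+n m (n * m)) (m≤m+n (suc n * m) r)
    drop-m : suc n * m + r ∸ m ≡ n * m + r
    drop-m = trans (cong (_∸ m) (+-assoc m (n * m) r)) (m+n∸m≡n m (n * m + r))

theorem5 : (m : ℕ) → .{{_ : NonZero m}} → 1 < m →
    (n r : ℕ) → 1 ≤ r → r < m →
    sf (n * m + r) m ≡ sumSf n m
theorem5 m 1<m zero    r 0<r r<m = sf-below-modulus m 1<m r 0<r r<m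
theorem5 m 1<m (suc n) r 0<r r<m = begin
  sf (suc n * m + r) m                   ≡⟨ sf-multiple+residue m 1<m n r 0<r r<m ⟩
  sf (suc n * m) m + sf (n * m + r) m    ≡⟨ cong₂ _+_ (sf-multiple m 1<m n) (theorem5 m 1<m n r 0<r r<m) ⟩
  sf (suc n) m + sumSf n m               ≡⟨ +-comm (sf (suc n) m) (sumSf n m) ⟩
  sumSf (suc n) m                        ∎
  where open ≡-Reasoning
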